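{- Let $\lambda$ be a partition of $N$, $\tau$ a reverse standard tableau of shape $\lambda$ and $v\in\mathbb{N}^N$. Then there exists a unique vertex of the graph $G_\lambda$ (defined below) of the form $(\tau,\zeta,v,\sigma)$.
   Context: $\alpha$ is an indeterminate. Partitions are drawn in French convention (rows numbered from bottom to top, columns from the left). A reverse standard tableau (RST) of shape $\lambda\vdash N$ is a bijective filling of the boxes with $1,\dots,N$ strictly decreasing along rows (left to right) and columns (bottom to top); $\mathrm{CT}_\tau[i]=c-r$ if $i$ is in column $c$, row $r$. $\tau_\lambda$ fills the columns left to right, each bottom to top, with $N,N-1,\dots,1$. $\tau^{(a,b)}$ denotes $\tau$ with entries $a,b$ interchanged. Permutations are vectors composed by $(\sigma\rho)[k]=\sigma[\rho[k]]$; for a vector $w$, $ws_i$ swaps entries $i,i+1$. Operations on 4-tuples $(\tau,\zeta,v,\sigma)$: $(\tau,\zeta,v,\sigma)s_i=(\tau,\zeta s_i,vs_i,\sigma s_i)$ if $v[i]\ne v[i+1]$; $=(\tau^{(\sigma[i],\sigma[i+1])},\zeta s_i,v,\sigma)$ if $v[i]=v[i+1]$ and $\tau^{(\sigma[i],\sigma[i+1])}$ is an RST; $=(\tau,\zeta,v,\sigma)$ otherwise. $(\tau,\zeta,v,\sigma)\Psi=(\tau,[\zeta[2],\dots,\zeta[N],\zeta[1]+\alpha],[v[2],\dots,v[N],v[1]+1],[\sigma[2],\dots,\sigma[N],\sigma[1]])$. The graph $G_\lambda$ has root $(\tau_\lambda,\mathrm{CT}_{\tau_\lambda},0^N,[1,\dots,N])$;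 from each vertex $X=(\tau,\zeta,v,\sigma)$ there is an edge labeled $\Psi$ to $X\Psi$, an edge labeled $s_i$ to $Xs_i$ if $v[i]<v[i+1]$ or if ($v[i]=v[i+1]$, $Xs_i\neq X$ and $\mathrm{CT}_\tau[\sigma[i]]-\mathrm{CT}_\tau[\sigma[i+1]]\ge2$), and an edge labeled $s_i$ to an extra vertex $\varnothing$ if $Xs_i=X$. Vertices are the 4-tuples reachable from the root. -}

module Defs where

open import Data.Nat as ℕ using (ℕ; zero; suc; _≤_; _<_; _≥_; _≤?_)
open import Data.Integer as ℤ using (ℤ; +_; _-_)
open import Data.Fin as Fin using (Fin; toℕ)
open import Data.List as List using (List; []; _∷_; length; filter; concatMap; upTo; reverse)
open import Data.Nat.ListAction using (sum)
open import Data.Nat.Properties using (<-trans; n<1+n)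
open import Data.List.Relation.Unary.All using (All)
open import Data.List.Relation.Unary.Linked using (Linked)
open import Data.Vec as Vec using (Vec; []; _∷_; lookup; _[_]≔_; _∷ʳ_)
open import Data.Product using (_×_; _,_; proj₁; proj₂; ∃-syntax)
open import Relation.Binary.PropositionalEquality using (_≡_; _≢_)

-- Rows are numbered 1,2,... from the bottom (French convention); row r has
-- (r-th part) boxes in columns 1..(r-th part).

record Partition (N : ℕ) : Set where
  field
    parts      : List ℕ
    decreasing : Linked _≥_ parts
    positive   : All (λ x → 1 ≤ x) parts
    sumParts   : sum parts ≡ N
open Partition public

-- length of row r (1-indexed); 0 if there is no such row
rowLen : List ℕ → ℕ → ℕ
rowLen _ zero = 0
rowLen [] (suc r) = 0
rowLen (x ∷ xs) (suc zero) = x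
rowLen (x ∷ xs) (suc (suc r)) = rowLen xs (suc r)

-- a box is a pair (row , column), both 1-indexed
Box : Set
Box = ℕ × ℕ

InShape : {N : ℕ} → Partition N → Box → Set
InShape λp (r , c) = 1 ≤ c × c ≤ rowLen (parts λp) r

-- Tableaux.  A filling of shape λ ⊢ N with 1..N is represented by the
-- vector of positions: entry (toℕ i + 1) sits in box  lookup τ i.

Tableau : ℕ → Set
Tableau N = Vec Box N

-- reverse standard tableau of shape λ: bijective filling (all positions in
-- the shape, pairwise distinct; with N entries and N boxes this is a
-- bijection), strictly decreasing along rows (left to right) and along
-- columns (bottom to top).
record IsRST {N : ℕ} (λp : Partition N) (τ : Tableau N) : Set where
  field
    inShape   : ∀ i → InShape λp (lookup τ i)
    injective : ∀ i j → lookup τ i ≡ lookup τ j → i ≡ j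
    rowDecr   : ∀ i j r c → lookup τ i ≡ (r , c) → lookup τ j ≡ (r , suc c)
                → toℕ j < toℕ i
    colDecr   : ∀ i j r c → lookup τ i ≡ (r , c) → lookup τ j ≡ (suc r , c)
                → toℕ j < toℕ i

CT : {N : ℕ} → Tableau N → Fin N → ℤ
CT τ i = (+ proj₂ (lookup τ i)) - (+ proj₁ (lookup τ i))

swapEntries : {N : ℕ} → Tableau N → Fin N → Fin N → Tableau N
swapEntries τ a b = (τ [ a ]≔ lookup τ b) [ b ]≔ lookup τ a

-- The root tableau τ_λ : columns filled left to right, each bottom to top,
-- with N, N-1, ..., 1.

-- Vec of length n from a list (truncating / padding with a default);
-- used only on lists of length exactly n.
toVec : {A : Set} → A → List A → (n : ℕ) → Vec A n
toVec d _ zero = []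
toVec d [] (suc n) = d ∷ toVec d [] n
toVec d (x ∷ xs) (suc n) = x ∷ toVec d xs n

firstPart : List ℕ → ℕ
firstPart [] = 0
firstPart (x ∷ _) = x

oneTo : ℕ → List ℕ
oneTo n = List.map suc (upTo n)

colLen : List ℕ → ℕ → ℕ
colLen ps c = length (filter (c ≤?_) ps)

columnOrder : List ℕ → List Box
columnOrder ps =
  concatMap (λ c → List.map (λ r → (r , c)) (oneTo (colLen ps c))) (oneTo (firstPart ps))

-- the k-th box (0-based) of columnOrder receives entry N - k, so entry j+1
-- sits at position N-1-j of columnOrder, i.e. position j of its reverse.
τroot : {N : ℕ} → Partition N → Tableau N
τroot {N} λp = toVec (0 , 0) (reverse (columnOrder (parts λp))) N

-- Vertices: 4-tuples (τ, ζ, v, σ).  ζ has entries in ℤ + ℕ·α, where α is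
-- an indeterminate; the pair (a , m) stands for a + m α.  σ is a
-- permutation vector with values in 1..N, value (toℕ k + 1) represented by k.

Zeta : Set
Zeta = ℤ × ℕ

record Vertex (N : ℕ) : Set where
  constructor ⟨_,_,_,_⟩
  field
    tab  : Tableau N
    zeta : Vec Zeta N
    vec  : Vec ℕ N
    perm : Vec (Fin N) N
open Vertex public

swapAt : {A : Set} {n : ℕ} → ℕ → Vec A n → Vec A n
swapAt zero (x ∷ y ∷ xs) = y ∷ x ∷ xs
swapAt (suc k) (x ∷ xs) = x ∷ swapAt k xs
swapAt _ xs = xs

rotate : {A : Set} {n : ℕ} → (A → A) → Vec A n → Vec A n
rotate f [] = []
rotate f (x ∷ xs) = xs ∷ʳ f x

Ψ : {N : ℕ} → Vertex N → Vertex N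
Ψ ⟨ τ , ζ , v , σ ⟩ =
  ⟨ τ , rotate (λ z → (proj₁ z , suc (proj₂ z))) ζ , rotate suc v , rotate (λ x → x) σ ⟩

root : {N : ℕ} → Partition N → Vertex N
root {N} λp =
  ⟨ τroot λp , Vec.tabulate (λ i → (CT (τroot λp) i , 0)) , Vec.replicate N 0
  , Vec.allFin N ⟩

-- Edges of G_λ between 4-tuples (edges to the extra vertex ∅ are not
-- needed to describe the set of 4-tuple vertices).  The label s_i
-- (1 ≤ i ≤ N-1) is encoded by k = i - 1 with k + 1 < N.

data Edge {N : ℕ} (λp : Partition N) : Vertex N → Vertex N → Set where
  edgeΨ : ∀ X → Edge λp X (Ψ X)
  edgeS< : ∀ τ ζ v σ k (k1 : suc k < N) →
           lookup v (Fin.fromℕ< (<-trans (n<1+n k) k1))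
             < lookup v (Fin.fromℕ< k1) →
           Edge λp ⟨ τ , ζ , v , σ ⟩ ⟨ τ , swapAt k ζ , swapAt k v , swapAt k σ ⟩
  edgeS= : ∀ τ ζ v σ k (k1 : suc k < N) →
           let a = lookup σ (Fin.fromℕ< (<-trans (n<1+n k) k1))
               b = lookup σ (Fin.fromℕ< k1)
           in lookup v (Fin.fromℕ< (<-trans (n<1+n k) k1)) ≡ lookup v (Fin.fromℕ< k1) →
              IsRST λp (swapEntries τ a b) →
              ⟨ swapEntries τ a b , swapAt k ζ , v , σ ⟩ ≢ ⟨ τ , ζ , v , σ ⟩ →
              (CT τ a - CT τ b) ℤ.≥ + 2 →
              Edge λp ⟨ τ , ζ , v , σ ⟩ ⟨ swapEntries τ a b , swapAt k ζ , v , σ ⟩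

-- vertices of G_λ that are 4-tuples: those reachable from the root
data Reachable {N : ℕ} (λp : Partition N) : Vertex N → Set where
  base : Reachable λp (root λp)
  step : ∀ {X Y} → Reachable λp X → Edge λp X Y → Reachable λp Y

module Submission where

-- Every reachable vertex is coherent: σ is the permutation
-- i ↦ rank v i that sorts v decreasingly (ties by position), and
-- ζ[i] = CT_τ[σ[i]] + v[i]·α.  Both are functions of τ and v.  Coherence
-- holds at the root and is preserved by Ψ and by both kinds of s-edges.
--
-- Existence, in two steps.  (1) Every RST τ occurs as ⟨ τ , ζ , 0ᴺ , id ⟩.
-- List the boxes of τ by entry: if they run backwards in column order then
-- τ = τ_λ, the root.  Otherwise two consecutive entries k+1, k+2 sit in boxes
-- that are in column order; these boxes share no row and no column and their
-- contents differ by at least 2, so exchanging the two entries gives an RST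
-- with fewer inversions, reachable by induction, from which one exchange
-- edge s_{k+1} leads back to τ.  (2) From ⟨ τ , ζ , 0ᴺ , id ⟩ every v is
-- reached, by induction on the sum of v and then on a positional weight:
-- a descent of v is undone by an s-edge, a weakly increasing nonzero v is
-- the image of a Ψ-edge.

open import Defs
open import Data.Nat using (ℕ)
open import Data.Integer using (ℤ)
open import Data.Fin using (Fin)
open import Data.Vec using (Vec)
open import Data.Product using (_×_; _,_; ∃-syntax)
open import Relation.Binary.PropositionalEquality using (_≡_)

open import Data.Bool using (Bool; true; false)
open import Data.Empty using (⊥-elim)
open import Data.Fin as Fin using (toℕ; fromℕ<; fromℕ; inject₁) renaming (zero to fz; suc to fs)
import Data.Fin.Properties as FinP
import Data.Integer as ℤ
import Data.Integer.Properties as ℤP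
open import Data.Integer.Tactic.RingSolver using (solve-∀)
open import Data.Nat as ℕ using (zero; suc; _+_; _*_; _∸_; _≤_; _<_; _≥_; z≤n; s≤s; _<ᵇ_; _≡ᵇ_)
import Data.Nat.Properties as ℕP
open import Data.Nat.Properties using (<-trans; n<1+n)
open import Algebra.Properties.CommutativeSemigroup ℕP.+-commutativeSemigroup
  using (interchange; x∙yz≈y∙xz; x∙yz≈yx∙z)
open import Data.Product using (proj₁; proj₂; ∃; map₂; swap)
open import Data.Product.Properties using (≡-dec)
open import Data.Product.Relation.Binary.Lex.Strict using (×-Lex; ×-transitive; ×-asymmetric; ×-decidable)
open import Data.List as List using (List; []; _∷_; length; _++_)
import Data.List.Properties as ListP
import Data.Nat.ListAction as ListAction
open import Data.List.Membership.Propositional using (_∈_; find)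
open import Data.List.Relation.Unary.All as All using (All; []; _∷_)
import Data.List.Relation.Unary.All.Properties as AllP
open import Data.List.Relation.Unary.AllPairs as AllPairs using (AllPairs; []; _∷_)
import Data.List.Relation.Unary.AllPairs.Properties as AllPairsP
import Data.List.Relation.Unary.Linked.Properties as LinkedP
open import Data.List.Relation.Unary.Linked.Properties using (Linked⇒All)
import Data.List.Membership.Propositional.Properties as MemP
open import Data.List.Relation.Unary.Any as Any using (Any; here; there)
import Data.List.Relation.Unary.Any.Properties as AnyP
open import Data.List.Relation.Unary.Linked as Linked using (Linked; [-]; _∷_)
open import Data.Sum using (_⊎_; inj₁; inj₂)
open import Data.Vec as Vec using ([]; _∷_; lookup; map; sum; replicate; allFin; _∷ʳ_)
import Data.Vec.Properties as VecP
import Data.Vec.Membership.Propositional.Properties as VecMemP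
import Data.Vec.Relation.Unary.Any as VecAny
import Data.Vec.Relation.Unary.Any.Properties as VecAnyP
open import Function using (_∘_; flip)
open import Relation.Binary.PropositionalEquality
  using (_≢_; refl; sym; trans; cong; cong₂; subst; subst₂; module ≡-Reasoning)
import Relation.Binary.PropositionalEquality as PropEq
open import Relation.Binary.Definitions using (tri<; tri≈; tri>)
open import Relation.Nullary using (¬_; Dec; does; yes; no)
open import Relation.Nullary.Decidable using (dec-true; dec-false)

private
  variable
    A B : Set
    n : ℕ

vec-ext : (u w : Vec A n) → (∀ i → lookup u i ≡ lookup w i) → u ≡ w
vec-ext u w same =
  trans (sym (VecP.tabulate∘lookup u)) (trans (VecP.tabulate-cong same) (VecP.tabulate∘lookup w))

-- The 0-based positions k and k+1 of a vector of length n, written exactly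
-- as the edges s_{k+1} of G_λ refer to them.
lo : ∀ {k} → suc k < n → Fin n
lo {k = k} k1 = fromℕ< (<-trans (n<1+n k) k1)

hi : ∀ {k} → suc k < n → Fin n
hi k1 = fromℕ< k1

toℕ-lo : ∀ {k} (k1 : suc k < n) → toℕ (lo k1) ≡ k
toℕ-lo k1 = FinP.toℕ-fromℕ< _

toℕ-hi : ∀ {k} (k1 : suc k < n) → toℕ (hi k1) ≡ suc k
toℕ-hi k1 = FinP.toℕ-fromℕ< k1

lo≢hi : ∀ {k} (k1 : suc k < n) → lo k1 ≢ hi k1
lo≢hi k1 e = ℕP.1+n≢n (sym (trans (sym (toℕ-lo k1)) (trans (cong toℕ e) (toℕ-hi k1))))

swapAt-involutive : ∀ k (v : Vec A n) → swapAt k (swapAt k v) ≡ v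
swapAt-involutive zero [] = refl
swapAt-involutive zero (x ∷ []) = refl
swapAt-involutive zero (x ∷ y ∷ v) = refl
swapAt-involutive (suc k) [] = refl
swapAt-involutive (suc k) (x ∷ v) = cong (x ∷_) (swapAt-involutive k v)

map-swapAt : ∀ (f : A → B) k (v : Vec A n) → map f (swapAt k v) ≡ swapAt k (map f v)
map-swapAt f zero [] = refl
map-swapAt f zero (x ∷ []) = refl
map-swapAt f zero (x ∷ y ∷ v) = refl
map-swapAt f (suc k) [] = refl
map-swapAt f (suc k) (x ∷ v) = cong (f x ∷_) (map-swapAt f k v)

sum-swapAt : ∀ k (v : Vec ℕ n) → sum (swapAt k v) ≡ sum v
sum-swapAt zero [] = refl
sum-swapAt zero (x ∷ []) = refl
sum-swapAt zero (x ∷ y ∷ v) = x∙yz≈y∙xz y x (sum v)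
sum-swapAt (suc k) [] = refl
sum-swapAt (suc k) (x ∷ v) = cong (x +_) (sum-swapAt k v)

-- The transposition of the indices k and k+1 (the identity if k+1 is out
-- of range): the index permutation along which swapAt k moves entries.
swap01 : Fin n → Fin n
swap01 {suc (suc _)} fz = fs fz
swap01 {suc (suc _)} (fs fz) = fz
swap01 {suc (suc _)} (fs (fs i)) = fs (fs i)
swap01 {suc zero} fz = fz

swapIx : ℕ → Fin n → Fin n
swapIx zero i = swap01 i
swapIx (suc k) fz = fz
swapIx (suc k) (fs i) = fs (swapIx k i)

lookup-swapAt : ∀ k (v : Vec A n) i → lookup (swapAt k v) i ≡ lookup v (swapIx k i)
lookup-swapAt zero (x ∷ y ∷ v) fz = refl
lookup-swapAt zero (x ∷ y ∷ v) (fs fz) = refl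
lookup-swapAt zero (x ∷ y ∷ v) (fs (fs i)) = refl
lookup-swapAt zero (x ∷ []) fz = refl
lookup-swapAt (suc k) (x ∷ v) fz = refl
lookup-swapAt (suc k) (x ∷ v) (fs i) = lookup-swapAt k v i

swapIx-involutive : ∀ k (i : Fin n) → swapIx k (swapIx k i) ≡ i
swapIx-involutive {suc (suc _)} zero fz = refl
swapIx-involutive {suc (suc _)} zero (fs fz) = refl
swapIx-involutive {suc (suc _)} zero (fs (fs i)) = refl
swapIx-involutive {suc zero} zero fz = refl
swapIx-involutive (suc k) fz = refl
swapIx-involutive (suc k) (fs i) = cong fs (swapIx-involutive k i)

swapIx-injective : ∀ k {i j : Fin n} → swapIx k i ≡ swapIx k j → i ≡ j
swapIx-injective k {i} {j} e =
  trans (sym (swapIx-involutive k i)) (trans (cong (swapIx k) e) (swapIx-involutive k j))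

swapIx-lo : ∀ {k} (k1 : suc k < n) → swapIx k (lo k1) ≡ hi k1
swapIx-lo {suc (suc _)} {zero} (s≤s (s≤s _)) = refl
swapIx-lo {suc (suc _)} {suc k} (s≤s k1) = cong fs (swapIx-lo k1)

swapIx-hi : ∀ {k} (k1 : suc k < n) → swapIx k (hi k1) ≡ lo k1
swapIx-hi {k = k} k1 = trans (cong (swapIx k) (sym (swapIx-lo k1))) (swapIx-involutive k _)

swapIx-elsewhere : ∀ k (i : Fin n) → toℕ i ≢ k → toℕ i ≢ suc k → swapIx k i ≡ i
swapIx-elsewhere {suc (suc _)} zero fz i≢k _ = ⊥-elim (i≢k refl)
swapIx-elsewhere {suc (suc _)} zero (fs fz) _ i≢k+1 = ⊥-elim (i≢k+1 refl)
swapIx-elsewhere {suc (suc _)} zero (fs (fs i)) _ _ = refl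
swapIx-elsewhere {suc zero} zero fz _ _ = refl
swapIx-elsewhere (suc k) fz _ _ = refl
swapIx-elsewhere (suc k) (fs i) i≢k i≢k+1 =
  cong fs (swapIx-elsewhere k i (i≢k ∘ cong suc) (i≢k+1 ∘ cong suc))

swapIx-monotone : ∀ k (i j : Fin n) → toℕ i < toℕ j →
                  toℕ (swapIx k i) < toℕ (swapIx k j) ⊎ (toℕ i ≡ k × toℕ j ≡ suc k)
swapIx-monotone {suc (suc _)} zero fz (fs fz) _ = inj₂ (refl , refl)
swapIx-monotone {suc (suc _)} zero fz (fs (fs j)) _ = inj₁ (s≤s (s≤s z≤n))
swapIx-monotone {suc (suc _)} zero (fs fz) (fs (fs j)) _ = inj₁ (s≤s z≤n)
swapIx-monotone {suc (suc _)} zero (fs (fs i)) (fs (fs j)) i<j = inj₁ i<j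
swapIx-monotone {suc (suc _)} zero (fs fz) (fs fz) (s≤s ())
swapIx-monotone {suc (suc _)} zero (fs (fs i)) (fs fz) (s≤s ())
swapIx-monotone {suc zero} zero fz fz ()
swapIx-monotone (suc k) fz (fs j) _ = inj₁ (s≤s z≤n)
swapIx-monotone (suc k) (fs i) (fs j) (s≤s i<j) with swapIx-monotone k i j i<j
... | inj₁ lt = inj₁ (s≤s lt)
... | inj₂ (i≡k , j≡k+1) = inj₂ (cong suc i≡k , cong suc j≡k+1)

swapEntries-fst : (τ : Tableau n) (a b : Fin n) → lookup (swapEntries τ a b) a ≡ lookup τ b
swapEntries-fst τ a b with a FinP.≟ b
... | yes refl = VecP.lookup∘update a (τ Vec.[ a ]≔ lookup τ a) (lookup τ a)
... | no a≢b = trans (VecP.lookup∘update′ a≢b (τ Vec.[ a ]≔ lookup τ b) (lookup τ a))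
                     (VecP.lookup∘update a τ (lookup τ b))

swapEntries-snd : (τ : Tableau n) (a b : Fin n) → lookup (swapEntries τ a b) b ≡ lookup τ a
swapEntries-snd τ a b = VecP.lookup∘update b (τ Vec.[ a ]≔ lookup τ b) (lookup τ a)

swapEntries-other : (τ : Tableau n) (a b c : Fin n) → c ≢ a → c ≢ b →
                    lookup (swapEntries τ a b) c ≡ lookup τ c
swapEntries-other τ a b c c≢a c≢b =
  trans (VecP.lookup∘update′ c≢b (τ Vec.[ a ]≔ lookup τ b) (lookup τ a))
        (VecP.lookup∘update′ c≢a τ (lookup τ b))

swapEntries-adjacent : ∀ {k} (k1 : suc k < n) (v : Tableau n) → swapEntries v (lo k1) (hi k1) ≡ swapAt k v
swapEntries-adjacent {k = k} k1 v = vec-ext _ _ entry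
  where
  entry : ∀ i → lookup (swapEntries v (lo k1) (hi k1)) i ≡ lookup (swapAt k v) i
  entry i with toℕ i ℕ.≟ k | toℕ i ℕ.≟ suc k
  ... | yes i≡k | _ rewrite FinP.toℕ-injective (trans i≡k (sym (toℕ-lo k1))) =
    trans (swapEntries-fst v (lo k1) (hi k1))
          (sym (trans (lookup-swapAt k v (lo k1)) (cong (lookup v) (swapIx-lo k1))))
  ... | no _ | yes i≡k+1 rewrite FinP.toℕ-injective (trans i≡k+1 (sym (toℕ-hi k1))) =
    trans (swapEntries-snd v (lo k1) (hi k1))
          (sym (trans (lookup-swapAt k v (hi k1)) (cong (lookup v) (swapIx-hi k1))))
  ... | no i≢k | no i≢k+1 =
    trans (swapEntries-other v (lo k1) (hi k1) i (i≢k ∘ at (toℕ-lo k1)) (i≢k+1 ∘ at (toℕ-hi k1)))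
          (sym (trans (lookup-swapAt k v i) (cong (lookup v) (swapIx-elsewhere k i i≢k i≢k+1))))
    where
    at : ∀ {p m} → toℕ p ≡ m → i ≡ p → toℕ i ≡ m
    at e refl = e

data LastOrInject : Fin (suc n) → Set where
  isLast   : LastOrInject (fromℕ n)
  isInject : (j : Fin n) → LastOrInject (inject₁ j)

lastOrInject : (i : Fin (suc n)) → LastOrInject i
lastOrInject {zero} fz = isLast
lastOrInject {suc _} fz = isInject fz
lastOrInject {suc _} (fs i) with lastOrInject i
... | isLast = isLast
... | isInject j = isInject (fs j)

lookup-∷ʳ-last : (xs : Vec A n) (y : A) → lookup (xs ∷ʳ y) (fromℕ n) ≡ y
lookup-∷ʳ-last [] y = refl
lookup-∷ʳ-last (x ∷ xs) y = lookup-∷ʳ-last xs y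

lookup-∷ʳ-inject : (xs : Vec A n) (y : A) (j : Fin n) → lookup (xs ∷ʳ y) (inject₁ j) ≡ lookup xs j
lookup-∷ʳ-inject (x ∷ xs) y fz = refl
lookup-∷ʳ-inject (x ∷ xs) y (fs j) = lookup-∷ʳ-inject xs y j

sum-∷ʳ : (xs : Vec ℕ n) (y : ℕ) → sum (xs ∷ʳ y) ≡ sum xs + y
sum-∷ʳ [] y = ℕP.+-comm y 0
sum-∷ʳ (x ∷ xs) y = trans (cong (x +_) (sum-∷ʳ xs y)) (sym (ℕP.+-assoc x (sum xs) y))

𝟙 : Bool → ℕ
𝟙 true = 1
𝟙 false = 0

𝟙-<ᵇ-refl : ∀ x → 𝟙 (x <ᵇ x) ≡ 0
𝟙-<ᵇ-refl zero = refl
𝟙-<ᵇ-refl (suc x) = 𝟙-<ᵇ-refl x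

𝟙-≡ᵇ-≢ : ∀ {a b} → a ≢ b → 𝟙 (a ≡ᵇ b) ≡ 0
𝟙-≡ᵇ-≢ {zero} {zero} a≢b = ⊥-elim (a≢b refl)
𝟙-≡ᵇ-≢ {zero} {suc b} _ = refl
𝟙-≡ᵇ-≢ {suc a} {zero} _ = refl
𝟙-≡ᵇ-≢ {suc a} {suc b} a≢b = 𝟙-≡ᵇ-≢ (a≢b ∘ cong suc)

𝟙-<ᵇ-suc : ∀ y x → 𝟙 (y <ᵇ suc x) ≡ 𝟙 (y <ᵇ x) + 𝟙 (x ≡ᵇ y)
𝟙-<ᵇ-suc zero zero = refl
𝟙-<ᵇ-suc zero (suc x) = refl
𝟙-<ᵇ-suc (suc y) zero = refl
𝟙-<ᵇ-suc (suc y) (suc x) = 𝟙-<ᵇ-suc y x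

𝟙-suc-<ᵇ : ∀ x z → 𝟙 (x <ᵇ z) ≡ 𝟙 (suc x <ᵇ z) + 𝟙 (z ≡ᵇ suc x)
𝟙-suc-<ᵇ zero zero = refl
𝟙-suc-<ᵇ zero (suc zero) = refl
𝟙-suc-<ᵇ zero (suc (suc z)) = refl
𝟙-suc-<ᵇ (suc x) zero = refl
𝟙-suc-<ᵇ (suc x) (suc z) = 𝟙-suc-<ᵇ x z

tally : (A → Bool) → Vec A n → ℕ
tally p v = sum (map (𝟙 ∘ p) v)

tally-swapAt : ∀ (p : A → Bool) k (v : Vec A n) → tally p (swapAt k v) ≡ tally p v
tally-swapAt p k v = trans (cong sum (map-swapAt (𝟙 ∘ p) k v)) (sum-swapAt k (map (𝟙 ∘ p) v))

tally-∷ʳ : ∀ (p : A → Bool) (xs : Vec A n) y → tally p (xs ∷ʳ y) ≡ tally p xs + 𝟙 (p y)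
tally-∷ʳ p xs y = trans (cong sum (VecP.map-∷ʳ (𝟙 ∘ p) y xs)) (sum-∷ʳ (map (𝟙 ∘ p) xs) (𝟙 (p y)))

tally-split : ∀ (p q r : A → Bool) → (∀ x → 𝟙 (p x) ≡ 𝟙 (q x) + 𝟙 (r x)) →
              (v : Vec A n) → tally p v ≡ tally q v + tally r v
tally-split p q r split [] = refl
tally-split p q r split (x ∷ v) =
  trans (cong₂ _+_ (split x) (tally-split p q r split v)) (interchange (𝟙 (q x)) (𝟙 (r x)) _ _)

equalBefore : ℕ → Fin n → Vec ℕ n → ℕ
equalBefore y fz _ = 0
equalBefore y (fs i) (x ∷ xs) = 𝟙 (x ≡ᵇ y) + equalBefore y i xs

equalBefore-∷ʳ-inject : ∀ y (xs : Vec ℕ n) z j → equalBefore y (inject₁ j) (xs ∷ʳ z) ≡ equalBefore y j xs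
equalBefore-∷ʳ-inject y (x ∷ xs) z fz = refl
equalBefore-∷ʳ-inject y (x ∷ xs) z (fs j) = cong (𝟙 (x ≡ᵇ y) +_) (equalBefore-∷ʳ-inject y xs z j)

equalBefore-∷ʳ-last : ∀ y (xs : Vec ℕ n) z → equalBefore y (fromℕ n) (xs ∷ʳ z) ≡ tally (_≡ᵇ y) xs
equalBefore-∷ʳ-last y [] z = refl
equalBefore-∷ʳ-last y (x ∷ xs) z = cong (𝟙 (x ≡ᵇ y) +_) (equalBefore-∷ʳ-last y xs z)

equalBefore-swapAt : ∀ {k} (k1 : suc k < n) (v : Vec ℕ n) → lookup v (lo k1) ≢ lookup v (hi k1) →
  ∀ i → let y = lookup v (swapIx k i) in equalBefore y i (swapAt k v) ≡ equalBefore y (swapIx k i) v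
equalBefore-swapAt {k = zero} (s≤s (s≤s _)) (a ∷ b ∷ v) a≢b fz = sym (cong (_+ 0) (𝟙-≡ᵇ-≢ a≢b))
equalBefore-swapAt {k = zero} (s≤s (s≤s _)) (a ∷ b ∷ v) a≢b (fs fz) = cong (_+ 0) (𝟙-≡ᵇ-≢ (a≢b ∘ sym))
equalBefore-swapAt {k = zero} (s≤s (s≤s _)) (a ∷ b ∷ v) a≢b (fs (fs j)) =
  x∙yz≈y∙xz (𝟙 (b ≡ᵇ lookup v j)) (𝟙 (a ≡ᵇ lookup v j)) _
equalBefore-swapAt {k = suc k} (s≤s k1) (x ∷ v) x≢y fz = refl
equalBefore-swapAt {k = suc k} (s≤s k1) (x ∷ v) x≢y (fs j) =
  cong (𝟙 (x ≡ᵇ lookup v (swapIx k j)) +_) (equalBefore-swapAt k1 v x≢y j)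

-- rank v i is the 0-based place of position i when the entries of v are
-- sorted decreasingly, ties broken by position.  In every vertex of G_λ the
-- permutation σ is i ↦ rank v i (see Coherent below).
rank : Vec ℕ n → Fin n → ℕ
rank v i = tally (lookup v i <ᵇ_) v + equalBefore (lookup v i) i v

rank-zero : (i : Fin n) → rank (replicate n 0) i ≡ toℕ i
rank-zero {n} i rewrite VecP.lookup-replicate i 0 = cong₂ _+_ (nothing-above n) (all-equal i)
  where
  nothing-above : ∀ m → tally (0 <ᵇ_) (replicate m 0) ≡ 0
  nothing-above zero = refl
  nothing-above (suc m) = nothing-above m
  all-equal : ∀ {m} (j : Fin m) → equalBefore 0 j (replicate m 0) ≡ toℕ j
  all-equal fz = refl
  all-equal (fs j) = cong suc (all-equal j)

rank-swapAt : ∀ {k} (k1 : suc k < n) (v : Vec ℕ n) → lookup v (lo k1) ≢ lookup v (hi k1) →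
              ∀ i → rank (swapAt k v) i ≡ rank v (swapIx k i)
rank-swapAt {k = k} k1 v ne i = begin
    rank (swapAt k v) i
  ≡⟨ cong (λ z → tally (z <ᵇ_) (swapAt k v) + equalBefore z i (swapAt k v)) (lookup-swapAt k v i) ⟩
    tally (y <ᵇ_) (swapAt k v) + equalBefore y i (swapAt k v)
  ≡⟨ cong₂ _+_ (tally-swapAt (y <ᵇ_) k v) (equalBefore-swapAt k1 v ne i) ⟩
    rank v (swapIx k i) ∎
  where
  open ≡-Reasoning
  y = lookup v (swapIx k i)

rank-rotate-inject : ∀ x (xs : Vec ℕ n) j → rank (xs ∷ʳ suc x) (inject₁ j) ≡ rank (x ∷ xs) (fs j)
rank-rotate-inject x xs j rewrite lookup-∷ʳ-inject xs (suc x) j = begin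
    tally (y <ᵇ_) (xs ∷ʳ suc x) + equalBefore y (inject₁ j) (xs ∷ʳ suc x)
  ≡⟨ cong₂ _+_ (tally-∷ʳ (y <ᵇ_) xs (suc x)) (equalBefore-∷ʳ-inject y xs (suc x) j) ⟩
    tally (y <ᵇ_) xs + 𝟙 (y <ᵇ suc x) + equalBefore y j xs
  ≡⟨ cong (λ z → tally (y <ᵇ_) xs + z + equalBefore y j xs) (𝟙-<ᵇ-suc y x) ⟩
    tally (y <ᵇ_) xs + (𝟙 (y <ᵇ x) + 𝟙 (x ≡ᵇ y)) + equalBefore y j xs
  ≡⟨ cong (_+ equalBefore y j xs) (x∙yz≈yx∙z (tally (y <ᵇ_) xs) (𝟙 (y <ᵇ x)) (𝟙 (x ≡ᵇ y))) ⟩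
    𝟙 (y <ᵇ x) + tally (y <ᵇ_) xs + 𝟙 (x ≡ᵇ y) + equalBefore y j xs
  ≡⟨ ℕP.+-assoc (𝟙 (y <ᵇ x) + tally (y <ᵇ_) xs) (𝟙 (x ≡ᵇ y)) (equalBefore y j xs) ⟩
    rank (x ∷ xs) (fs j) ∎
  where
  open ≡-Reasoning
  y = lookup xs j

rank-rotate-last : ∀ x (xs : Vec ℕ n) → rank (xs ∷ʳ suc x) (fromℕ n) ≡ rank (x ∷ xs) fz
rank-rotate-last {n} x xs rewrite lookup-∷ʳ-last xs (suc x) = begin
    tally (suc x <ᵇ_) (xs ∷ʳ suc x) + equalBefore (suc x) (fromℕ n) (xs ∷ʳ suc x)
  ≡⟨ cong₂ _+_ (tally-∷ʳ (suc x <ᵇ_) xs (suc x)) (equalBefore-∷ʳ-last (suc x) xs (suc x)) ⟩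
    tally (suc x <ᵇ_) xs + 𝟙 (suc x <ᵇ suc x) + tally (_≡ᵇ suc x) xs
  ≡⟨ cong (λ z → tally (suc x <ᵇ_) xs + z + tally (_≡ᵇ suc x) xs) (𝟙-<ᵇ-refl (suc x)) ⟩
    tally (suc x <ᵇ_) xs + 0 + tally (_≡ᵇ suc x) xs
  ≡⟨ cong (_+ tally (_≡ᵇ suc x) xs) (ℕP.+-identityʳ _) ⟩
    tally (suc x <ᵇ_) xs + tally (_≡ᵇ suc x) xs
  ≡⟨ tally-split (x <ᵇ_) (suc x <ᵇ_) (_≡ᵇ suc x) (𝟙-suc-<ᵇ x) xs ⟨
    tally (x <ᵇ_) xs
  ≡⟨ cong (_+ tally (x <ᵇ_) xs) (𝟙-<ᵇ-refl x) ⟨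
    𝟙 (x <ᵇ x) + tally (x <ᵇ_) xs
  ≡⟨ ℕP.+-identityʳ _ ⟨
    rank (x ∷ xs) fz ∎
  where open ≡-Reasoning

content : Box → ℤ
content (r , c) = ℤ.+ c ℤ.- ℤ.+ r

-- The invariant satisfied by every vertex ⟨ τ , ζ , v , σ ⟩ of G_λ:
-- ζ[i] = CT_τ[σ[i]] + v[i]·α, and σ is the injective map i ↦ rank v i.
record Coherent (X : Vertex n) : Set where
  field
    zeta-spec      : ∀ i → lookup (zeta X) i ≡ (CT (tab X) (lookup (perm X) i) , lookup (vec X) i)
    perm-injective : ∀ i j → lookup (perm X) i ≡ lookup (perm X) j → i ≡ j
    perm-rank      : ∀ i → toℕ (lookup (perm X) i) ≡ rank (vec X) i
open Coherent

coherent-unique : ∀ {τ : Tableau n} {ζ ζ′ v σ σ′} →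
  Coherent ⟨ τ , ζ , v , σ ⟩ → Coherent ⟨ τ , ζ′ , v , σ′ ⟩ → ζ′ ≡ ζ × σ′ ≡ σ
coherent-unique {τ = τ} {ζ} {ζ′} {v} {σ} {σ′} C C′ = same-ζ , same-σ
  where
  same-σ : σ′ ≡ σ
  same-σ = vec-ext σ′ σ (λ i → FinP.toℕ-injective (trans (perm-rank C′ i) (sym (perm-rank C i))))
  same-ζ : ζ′ ≡ ζ
  same-ζ = vec-ext ζ′ ζ λ i →
    trans (zeta-spec C′ i) (trans (cong (λ s → (CT τ (lookup s i) , lookup v i)) same-σ) (sym (zeta-spec C i)))

coherent-root : (λp : Partition n) → Coherent (root λp)
coherent-root {n} λp = record
  { zeta-spec = λ i → trans (VecP.lookup∘tabulate _ i)
      (cong₂ _,_ (cong (CT (τroot λp)) (sym (VecP.lookup-allFin i))) (sym (VecP.lookup-replicate i 0)))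
  ; perm-injective = λ i j e → trans (sym (VecP.lookup-allFin i)) (trans e (VecP.lookup-allFin j))
  ; perm-rank = λ i → trans (cong toℕ (VecP.lookup-allFin i)) (sym (rank-zero i)) }

-- Ψ rotates ζ, v and σ together, adding α and 1 to the entry moved to the
-- end; the ranks rotate along.
coherent-Ψ : ∀ (τ : Tableau n) ζ v σ → Coherent ⟨ τ , ζ , v , σ ⟩ → Coherent (Ψ ⟨ τ , ζ , v , σ ⟩)
coherent-Ψ τ [] [] [] _ = record { zeta-spec = λ () ; perm-injective = λ () ; perm-rank = λ () }
coherent-Ψ τ (z ∷ zs) (x ∷ xs) (s ∷ ss) C =
  record { zeta-spec = zeta-spec′ ; perm-injective = perm-injective′ ; perm-rank = perm-rank′ }
  where
  z′ : Zeta
  z′ = (proj₁ z , suc (proj₂ z))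

  zeta-spec′ : ∀ i → lookup (zs ∷ʳ z′) i ≡ (CT τ (lookup (ss ∷ʳ s) i) , lookup (xs ∷ʳ suc x) i)
  zeta-spec′ i with lastOrInject i
  ... | isLast rewrite lookup-∷ʳ-last zs z′ | lookup-∷ʳ-last ss s | lookup-∷ʳ-last xs (suc x) =
    cong (map₂ suc) (zeta-spec C fz)
  ... | isInject j rewrite lookup-∷ʳ-inject zs z′ j | lookup-∷ʳ-inject ss s j | lookup-∷ʳ-inject xs (suc x) j =
    zeta-spec C (fs j)

  perm-injective′ : ∀ i j → lookup (ss ∷ʳ s) i ≡ lookup (ss ∷ʳ s) j → i ≡ j
  perm-injective′ i j e with lastOrInject i | lastOrInject j
  ... | isLast | isLast = refl
  ... | isLast | isInject b
    rewrite lookup-∷ʳ-last ss s | lookup-∷ʳ-inject ss s b with () ← perm-injective C fz (fs b) e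
  perm-injective′ i j e | isInject a | isLast
    rewrite lookup-∷ʳ-last ss s | lookup-∷ʳ-inject ss s a with () ← perm-injective C (fs a) fz e
  perm-injective′ i j e | isInject a | isInject b
    rewrite lookup-∷ʳ-inject ss s a | lookup-∷ʳ-inject ss s b =
    cong inject₁ (FinP.suc-injective (perm-injective C (fs a) (fs b) e))

  perm-rank′ : ∀ i → toℕ (lookup (ss ∷ʳ s) i) ≡ rank (xs ∷ʳ suc x) i
  perm-rank′ i with lastOrInject i
  ... | isLast rewrite lookup-∷ʳ-last ss s = trans (perm-rank C fz) (sym (rank-rotate-last x xs))
  ... | isInject j rewrite lookup-∷ʳ-inject ss s j = trans (perm-rank C (fs j)) (sym (rank-rotate-inject x xs j))

-- Edge s_{k+1} when v[k] < v[k+1]: everything is permuted by the transposition.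
coherent-sort : ∀ (τ : Tableau n) ζ v σ {k} (k1 : suc k < n) → lookup v (lo k1) < lookup v (hi k1) →
  Coherent ⟨ τ , ζ , v , σ ⟩ → Coherent ⟨ τ , swapAt k ζ , swapAt k v , swapAt k σ ⟩
coherent-sort τ ζ v σ {k} k1 v<v C = record
  { zeta-spec = λ i → trans (lookup-swapAt k ζ i) (trans (zeta-spec C (swapIx k i))
      (sym (cong₂ _,_ (cong (CT τ) (lookup-swapAt k σ i)) (lookup-swapAt k v i))))
  ; perm-injective = λ i j e → swapIx-injective k
      (perm-injective C _ _ (trans (sym (lookup-swapAt k σ i)) (trans e (lookup-swapAt k σ j))))
  ; perm-rank = λ i → trans (cong toℕ (lookup-swapAt k σ i))
      (trans (perm-rank C (swapIx k i)) (sym (rank-swapAt k1 v (ℕP.<⇒≢ v<v) i))) }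

-- Edge s_{k+1} when v[k] = v[k+1]: the entries σ[k], σ[k+1] of τ are
-- exchanged, which exchanges the contents recorded in ζ[k], ζ[k+1].
coherent-exchange : ∀ (τ : Tableau n) ζ v σ {k} (k1 : suc k < n) → lookup v (lo k1) ≡ lookup v (hi k1) →
  Coherent ⟨ τ , ζ , v , σ ⟩ →
  Coherent ⟨ swapEntries τ (lookup σ (lo k1)) (lookup σ (hi k1)) , swapAt k ζ , v , σ ⟩
coherent-exchange {n} τ ζ v σ {k} k1 v≡v C =
  record { zeta-spec = zeta-spec′ ; perm-injective = perm-injective C ; perm-rank = perm-rank C }
  where
  a b : Fin n
  a = lookup σ (lo k1)
  b = lookup σ (hi k1)
  τ′ : Tableau n
  τ′ = swapEntries τ a b

  zeta-spec′ : ∀ i → lookup (swapAt k ζ) i ≡ (CT τ′ (lookup σ i) , lookup v i)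
  zeta-spec′ i with toℕ i ℕ.≟ k | toℕ i ℕ.≟ suc k
  ... | yes i≡k | _ rewrite FinP.toℕ-injective (trans i≡k (sym (toℕ-lo k1))) =
    trans (lookup-swapAt k ζ (lo k1)) (trans (cong (lookup ζ) (swapIx-lo k1))
      (trans (zeta-spec C (hi k1)) (sym (cong₂ _,_ (cong content (swapEntries-fst τ a b)) v≡v))))
  ... | no _ | yes i≡k+1 rewrite FinP.toℕ-injective (trans i≡k+1 (sym (toℕ-hi k1))) =
    trans (lookup-swapAt k ζ (hi k1)) (trans (cong (lookup ζ) (swapIx-hi k1))
      (trans (zeta-spec C (lo k1)) (cong₂ _,_ (sym (cong content (swapEntries-snd τ a b))) v≡v)))
  ... | no i≢k | no i≢k+1 =
    trans (lookup-swapAt k ζ i) (trans (cong (lookup ζ) (swapIx-elsewhere k i i≢k i≢k+1))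
      (trans (zeta-spec C i) (cong (_, lookup v i) (sym (cong content (swapEntries-other τ a b (lookup σ i)
        (λ e → i≢k (trans (cong toℕ (perm-injective C _ _ e)) (toℕ-lo k1)))
        (λ e → i≢k+1 (trans (cong toℕ (perm-injective C _ _ e)) (toℕ-hi k1)))))))))

coherent-reachable : ∀ (λp : Partition n) {X} → Reachable λp X → Coherent X
coherent-reachable λp base = coherent-root λp
coherent-reachable λp (step r (edgeΨ X)) = coherent-Ψ (tab X) (zeta X) (vec X) (perm X) (coherent-reachable λp r)
coherent-reachable λp (step r (edgeS< τ ζ v σ k k1 v<v)) = coherent-sort τ ζ v σ k1 v<v (coherent-reachable λp r)
coherent-reachable λp (step r (edgeS= τ ζ v σ k k1 v≡v _ _ _)) =
  coherent-exchange τ ζ v σ k1 v≡v (coherent-reachable λp r)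

-- A weight on ℕ-vectors: position i (0-based) of a vector of length n
-- counts with multiplicity n - i.  Sorting a descent decreases it.
weight : Vec ℕ n → ℕ
weight [] = 0
weight {suc n} (x ∷ xs) = suc n * x + weight xs

weight-swapAt : ∀ {k} (k1 : suc k < n) (v : Vec ℕ n) → lookup v (hi k1) < lookup v (lo k1) →
                weight (swapAt k v) < weight v
weight-swapAt {suc (suc m)} {zero} (s≤s (s≤s _)) (a ∷ b ∷ v) b<a = begin-strict
    suc (suc m) * b + (suc m * a + weight v)  ≡⟨ ℕP.+-assoc (suc (suc m) * b) (suc m * a) (weight v) ⟨
    suc (suc m) * b + suc m * a + weight v    <⟨ ℕP.+-monoˡ-< (weight v) heavier-first ⟩
    suc (suc m) * a + suc m * b + weight v    ≡⟨ ℕP.+-assoc (suc (suc m) * a) (suc m * b) (weight v) ⟩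
    suc (suc m) * a + (suc m * b + weight v)  ∎
  where
  open ℕP.≤-Reasoning
  heavier-first : suc (suc m) * b + suc m * a < suc (suc m) * a + suc m * b
  heavier-first = begin-strict
    suc (suc m) * b + suc m * a  ≡⟨ ℕP.+-assoc b (suc m * b) (suc m * a) ⟩
    b + (suc m * b + suc m * a)  <⟨ ℕP.+-monoˡ-< (suc m * b + suc m * a) b<a ⟩
    a + (suc m * b + suc m * a)  ≡⟨ cong (a +_) (ℕP.+-comm (suc m * b) (suc m * a)) ⟩
    a + (suc m * a + suc m * b)  ≡⟨ ℕP.+-assoc a (suc m * a) (suc m * b) ⟨
    suc (suc m) * a + suc m * b  ∎
weight-swapAt {suc n} {suc k} (s≤s k1) (x ∷ v) lt = ℕP.+-monoʳ-< (suc n * x) (weight-swapAt k1 v lt)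

sum-rotate : (w : Vec ℕ (suc n)) → sum (rotate suc w) ≡ suc (sum w)
sum-rotate (x ∷ xs) = trans (sum-∷ʳ xs (suc x)) (trans (ℕP.+-suc (sum xs) x) (cong suc (ℕP.+-comm (sum xs) x)))

data Reduction (v : Vec ℕ n) : Set where
  isZero   : v ≡ replicate n 0 → Reduction v
  rotation : (w : Vec ℕ n) → rotate suc w ≡ v → sum (rotate suc w) ≡ suc (sum w) → Reduction v
  descent  : ∀ {k} (k1 : suc k < n) → lookup v (hi k1) < lookup v (lo k1) → Reduction v

reduction : (v : Vec ℕ n) → Reduction v
reduction [] = isZero refl
reduction (zero ∷ []) = isZero refl
reduction (suc m ∷ []) = rotation (m ∷ []) refl (sum-rotate (m ∷ []))
reduction (x ∷ y ∷ ys) with reduction (y ∷ ys)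
reduction (zero ∷ y ∷ ys) | isZero y∷ys≡0 = isZero (cong (0 ∷_) y∷ys≡0)
reduction (suc m ∷ y ∷ ys) | isZero refl = descent (s≤s (s≤s z≤n)) (s≤s z≤n)
reduction (x ∷ y ∷ ys) | rotation (m ∷ ws) eq _ = rotation (m ∷ x ∷ ws) (cong (x ∷_) eq) (sum-rotate (m ∷ x ∷ ws))
reduction (x ∷ y ∷ ys) | descent k1 lt = descent (s≤s k1) lt

-- Once some vertex ⟨ τ , ζ , 0ᴺ , id ⟩ is reachable, a vertex ⟨ τ , _ , v , _ ⟩
-- is reachable for every v: induction on the sum of v, and for a fixed sum
-- on its weight; descents are undone by s-edges, rotations by Ψ-edges.
reachable-any-v : ∀ (λp : Partition n) (τ : Tableau n) →
  ∃[ ζ ] Reachable λp ⟨ τ , ζ , replicate n 0 , allFin n ⟩ →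
  ∀ v → ∃[ ζ ] ∃[ σ ] Reachable λp ⟨ τ , ζ , v , σ ⟩
reachable-any-v {n} λp τ (ζ₀ , r₀) v = by-size (sum v) (weight v) v ℕP.≤-refl ℕP.≤-refl
  where
  by-size : ∀ s w (v : Vec ℕ n) → sum v ≤ s → weight v ≤ w → ∃[ ζ ] ∃[ σ ] Reachable λp ⟨ τ , ζ , v , σ ⟩
  by-size s w v sv≤s wv≤w with reduction v
  ... | isZero refl = ζ₀ , allFin n , r₀
  by-size zero w v sv≤s wv≤w | rotation u refl sum≡ with () ← subst (_≤ 0) sum≡ sv≤s
  by-size (suc s) w v sv≤s wv≤w | rotation u refl sum≡
    with by-size s (weight u) u (ℕP.≤-pred (subst (_≤ suc s) sum≡ sv≤s)) ℕP.≤-refl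
  ... | ζ , σ , r = _ , _ , step r (edgeΨ ⟨ τ , ζ , u , σ ⟩)
  by-size s zero v sv≤s wv≤w | descent k1 lt with () ← ℕP.≤-trans (weight-swapAt k1 v lt) wv≤w
  by-size s (suc w) v sv≤s wv≤w | descent {k} k1 lt
    with by-size s w (swapAt k v) (subst (_≤ s) (sym (sum-swapAt k v)) sv≤s)
                                  (ℕP.≤-pred (ℕP.≤-trans (weight-swapAt k1 v lt) wv≤w))
  ... | ζ , σ , r = _ , _ , subst (λ u → Reachable λp ⟨ τ , swapAt k ζ , u , swapAt k σ ⟩) (swapAt-involutive k v)
                             (step r (edgeS< τ ζ (swapAt k v) σ k k1 sorted))
    where
    sorted : lookup (swapAt k v) (lo k1) < lookup (swapAt k v) (hi k1)
    sorted = subst₂ _<_ (sym (trans (lookup-swapAt k v (lo k1)) (cong (lookup v) (swapIx-lo k1))))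
                        (sym (trans (lookup-swapAt k v (hi k1)) (cong (lookup v) (swapIx-hi k1)))) lt

-- x ≺ y : box x precedes box y in column order (columns from left to
-- right, each from bottom to top), the order in which τ_λ is filled.
_≺_ : Box → Box → Set
x ≺ y = ×-Lex _≡_ _<_ _<_ (swap x) (swap y)

≺-trans : ∀ {x y z} → x ≺ y → y ≺ z → x ≺ z
≺-trans = ×-transitive {_<₂_ = _<_} PropEq.isEquivalence ℕP.<-resp₂-≡ ℕP.<-trans ℕP.<-trans

≺-asym : ∀ {x y} → x ≺ y → ¬ y ≺ x
≺-asym = ×-asymmetric {_<₂_ = _<_} sym ℕP.<-resp₂-≡ ℕP.<-asym ℕP.<-asym

≺-irrefl : ∀ {x} → ¬ x ≺ x
≺-irrefl x≺x = ≺-asym x≺x x≺x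

≺-dec : ∀ x y → Dec (x ≺ y)
≺-dec x y = ×-decidable ℕ._≟_ ℕ._<?_ ℕ._<?_ (swap x) (swap y)

≺-connex : ∀ x y → x ≢ y → x ≺ y ⊎ y ≺ x
≺-connex (r , c) (r′ , c′) x≢y with ℕP.<-cmp c c′
... | tri< c<c′ _ _ = inj₁ (inj₁ c<c′)
... | tri> _ _ c′<c = inj₂ (inj₁ c′<c)
... | tri≈ _ refl _ with ℕP.<-cmp r r′
... | tri< r<r′ _ _ = inj₁ (inj₂ (refl , r<r′))
... | tri> _ _ r′<r = inj₂ (inj₂ (refl , r′<r))
... | tri≈ _ refl _ = ⊥-elim (x≢y refl)

_≟Box_ : (x y : Box) → Dec (x ≡ y)
_≟Box_ = ≡-dec ℕ._≟_ ℕ._≟_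

rowLen-antitone : ∀ {ps} → Linked _≥_ ps → ∀ {r r′} → 1 ≤ r → r ≤ r′ → rowLen ps r′ ≤ rowLen ps r
rowLen-antitone L {suc r} {suc r′} _ (s≤s r≤r′) = shifted L r≤r′
  where
  second≤first : ∀ {y ys} → Linked _≥_ (y ∷ ys) → rowLen ys 1 ≤ y
  second≤first [-] = z≤n
  second≤first (y≥z ∷ _) = y≥z
  shifted : ∀ {ps} → Linked _≥_ ps → ∀ {a b} → a ≤ b → rowLen ps (suc b) ≤ rowLen ps (suc a)
  shifted {[]} _ _ = z≤n
  shifted {x ∷ xs} _ {zero} {zero} _ = ℕP.≤-refl
  shifted {x ∷ xs} L {zero} {suc b} _ = ℕP.≤-trans (shifted (Linked.tail L) z≤n) (second≤first L)
  shifted {x ∷ xs} L {suc a} {suc b} (s≤s a≤b) = shifted (Linked.tail L) a≤b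

inShape-row : ∀ (λp : Partition n) {r c} → InShape λp (r , c) → 1 ≤ r
inShape-row λp {zero} (1≤c , c≤0) = ⊥-elim (ℕP.<-irrefl refl (ℕP.≤-trans 1≤c c≤0))
inShape-row λp {suc r} _ = s≤s z≤n

shapeBoxes : ℕ → List ℕ → List Box
shapeBoxes r₀ [] = []
shapeBoxes r₀ (x ∷ xs) = List.map (r₀ ,_) (oneTo x) ++ shapeBoxes (suc r₀) xs

length-oneTo : ∀ m → length (oneTo m) ≡ m
length-oneTo m = trans (ListP.length-map suc (List.upTo m)) (ListP.length-upTo m)

∈-oneTo : ∀ {c m} → 1 ≤ c → c ≤ m → c ∈ oneTo m
∈-oneTo {suc c} _ c<m = MemP.∈-map⁺ suc (MemP.∈-upTo⁺ c<m)

∈-oneTo⁻ : ∀ {c m} → c ∈ oneTo m → 1 ≤ c × c ≤ m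
∈-oneTo⁻ m∈ with MemP.∈-map⁻ suc m∈
... | c , c∈ , refl = s≤s z≤n , MemP.∈-upTo⁻ c∈

length-shapeBoxes : ∀ r₀ ps → length (shapeBoxes r₀ ps) ≡ ListAction.sum ps
length-shapeBoxes r₀ [] = refl
length-shapeBoxes r₀ (x ∷ xs) = trans (ListP.length-++ (List.map (r₀ ,_) (oneTo x)))
  (cong₂ _+_ (trans (ListP.length-map (r₀ ,_) (oneTo x)) (length-oneTo x)) (length-shapeBoxes (suc r₀) xs))

∈-shapeBoxes : ∀ ps r₀ r c → 1 ≤ c → c ≤ rowLen ps (suc r) → (r + r₀ , c) ∈ shapeBoxes r₀ ps
∈-shapeBoxes [] r₀ r c 1≤c c≤0 = ⊥-elim (ℕP.<-irrefl refl (ℕP.≤-trans 1≤c c≤0))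
∈-shapeBoxes (x ∷ xs) r₀ zero c 1≤c c≤x = MemP.∈-++⁺ˡ (MemP.∈-map⁺ (r₀ ,_) (∈-oneTo 1≤c c≤x))
∈-shapeBoxes (x ∷ xs) r₀ (suc r) c 1≤c c≤ℓ =
  MemP.∈-++⁺ʳ (List.map (r₀ ,_) (oneTo x))
    (subst (λ r′ → (r′ , c) ∈ shapeBoxes (suc r₀) xs) (ℕP.+-suc r r₀) (∈-shapeBoxes xs (suc r₀) r c 1≤c c≤ℓ))

inShape⇒∈ : ∀ (λp : Partition n) {b} → InShape λp b → b ∈ shapeBoxes 1 (parts λp)
inShape⇒∈ λp {zero , c} (1≤c , c≤0) = ⊥-elim (ℕP.<-irrefl refl (ℕP.≤-trans 1≤c c≤0))
inShape⇒∈ λp {suc r , c} (1≤c , c≤ℓ) =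
  subst (λ r′ → (r′ , c) ∈ shapeBoxes 1 (parts λp)) (ℕP.+-comm r 1) (∈-shapeBoxes (parts λp) 1 r c 1≤c c≤ℓ)

injection-missing⇒< : ∀ {m l} (g : Fin m → Fin l) → (∀ {i j} → g i ≡ g j → i ≡ j) →
                      (p : Fin l) → (∀ i → g i ≢ p) → m < l
injection-missing⇒< {m} {suc l} g g-inj p missed =
  s≤s (FinP.injective⇒≤ {f = squeeze} λ e → g-inj (FinP.punchOut-injective (missed _ ∘ sym) (missed _ ∘ sym) e))
  where
  squeeze : Fin m → Fin l
  squeeze i = Fin.punchOut (missed i ∘ sym)

-- A reverse standard tableau fills every box of its shape: it injects its
-- N entries into the N boxes of the shape.
rst-onto : ∀ (λp : Partition n) {t : Tableau n} → IsRST λp t → ∀ {b} → InShape λp b → ∃ λ i → lookup t i ≡ b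
rst-onto {n} λp {t} rst {b} b-in with FinP.any? (λ i → lookup t i ≟Box b)
... | yes hit = hit
... | no miss = ⊥-elim (ℕP.<-irrefl refl
        (subst (n <_) (trans (length-shapeBoxes 1 (parts λp)) (sumParts λp))
          (injection-missing⇒< slot slot-injective (Any.index (inShape⇒∈ λp b-in)) slot-misses)))
  where
  boxes : List Box
  boxes = shapeBoxes 1 (parts λp)
  entry∈ : ∀ i → lookup t i ∈ boxes
  entry∈ i = inShape⇒∈ λp (IsRST.inShape rst i)
  slot : Fin n → Fin (length boxes)
  slot i = Any.index (entry∈ i)
  same-box : ∀ {i b′} (b′∈ : b′ ∈ boxes) → slot i ≡ Any.index b′∈ → lookup t i ≡ b′
  same-box {i} b′∈ e =
    trans (AnyP.lookup-index (entry∈ i)) (trans (cong (List.lookup boxes) e) (sym (AnyP.lookup-index b′∈)))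
  slot-injective : ∀ {i j} → slot i ≡ slot j → i ≡ j
  slot-injective {i} {j} e = IsRST.injective rst i j (same-box (entry∈ j) e)
  slot-misses : ∀ i → slot i ≢ Any.index (inShape⇒∈ λp b-in)
  slot-misses i e = miss (i , same-box (inShape⇒∈ λp b-in) e)

-- In a reverse standard tableau entries decrease strictly towards the
-- north-east, not only between neighbouring boxes.  Intermediate boxes exist
-- because the tableau fills its whole shape (rst-onto).
module _ {N : ℕ} (λp : Partition N) {t : Tableau N} (rst : IsRST λp t) where
  open IsRST rst

  private
    shape-of : ∀ {i b} → lookup t i ≡ b → InShape λp b
    shape-of {i} refl = inShape i

  decreasing-along-row : ∀ i j {r c c′} → c < c′ → lookup t i ≡ (r , c) → lookup t j ≡ (r , c′) → toℕ j < toℕ i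
  decreasing-along-row i j {r} {c} {suc c″} (s≤s c≤c″) ti tj with ℕP.m≤n⇒m<n∨m≡n c≤c″
  ... | inj₂ refl = rowDecr i j r c ti tj
  ... | inj₁ c<c″ with rst-onto λp rst middle-in-shape
    where
    middle-in-shape : InShape λp (r , c″)
    middle-in-shape = ℕP.<-≤-trans (s≤s z≤n) c<c″ , ℕP.≤-trans (ℕP.n≤1+n c″) (proj₂ (shape-of tj))
  ...   | m , tm = <-trans (rowDecr m j r c″ tm tj) (decreasing-along-row i m c<c″ ti tm)

  decreasing-along-column : ∀ i j {r r′ c} → r < r′ → lookup t i ≡ (r , c) → lookup t j ≡ (r′ , c) → toℕ j < toℕ i
  decreasing-along-column i j {r} {suc r″} {c} (s≤s r≤r″) ti tj with ℕP.m≤n⇒m<n∨m≡n r≤r″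
  ... | inj₂ refl = colDecr i j r c ti tj
  ... | inj₁ r<r″ with rst-onto λp rst middle-in-shape
    where
    middle-in-shape : InShape λp (r″ , c)
    middle-in-shape = proj₁ (shape-of tj) , ℕP.≤-trans (proj₂ (shape-of tj))
      (rowLen-antitone (decreasing λp) (ℕP.<-≤-trans (s≤s z≤n) r<r″) (ℕP.n≤1+n r″))
  ...   | m , tm = <-trans (colDecr m j r″ c tm tj) (decreasing-along-column i m r<r″ ti tm)

  decreasing-northeast : ∀ i j {r c r′ c′} → lookup t i ≡ (r , c) → lookup t j ≡ (r′ , c′) →
                         r ≤ r′ → c ≤ c′ → (r , c) ≢ (r′ , c′) → toℕ j < toℕ i
  decreasing-northeast i j {r} {c} {r′} {c′} ti tj r≤r′ c≤c′ distinct
    with ℕP.m≤n⇒m<n∨m≡n r≤r′ | ℕP.m≤n⇒m<n∨m≡n c≤c′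
  ... | inj₂ refl | inj₂ refl = ⊥-elim (distinct refl)
  ... | inj₂ refl | inj₁ c<c′ = decreasing-along-row i j c<c′ ti tj
  ... | inj₁ r<r′ | inj₂ refl = decreasing-along-column i j r<r′ ti tj
  ... | inj₁ r<r′ | inj₁ c<c′ with rst-onto λp rst corner-in-shape
    where
    corner-in-shape : InShape λp (r , c′)
    corner-in-shape = proj₁ (shape-of tj) , ℕP.≤-trans (proj₂ (shape-of tj))
      (rowLen-antitone (decreasing λp) (inShape-row λp (shape-of ti)) r≤r′)
  ...   | m , tm = <-trans (decreasing-along-column m j r<r′ tm tj) (decreasing-along-row i m c<c′ ti tm)

colLen-cons-≤ : ∀ {c x} xs → c ≤ x → colLen (x ∷ xs) c ≡ suc (colLen xs c)
colLen-cons-≤ {c} xs c≤x = cong length (ListP.filter-accept (c ℕ.≤?_) c≤x)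

colLen-short : ∀ {c} xs → All (_< c) xs → colLen xs c ≡ 0
colLen-short {c} xs short = cong length (ListP.filter-none (c ℕ.≤?_) (All.map (λ x<c c≤x → ℕP.<⇒≱ x<c c≤x) short))

colLen⇒rowLen : ∀ {ps} → Linked _≥_ ps → ∀ {c r} → 1 ≤ r → r ≤ colLen ps c → c ≤ rowLen ps r
colLen⇒rowLen {[]} _ 1≤r r≤0 = ⊥-elim (ℕP.<-irrefl refl (ℕP.≤-trans 1≤r r≤0))
colLen⇒rowLen {x ∷ xs} L {c} {r} 1≤r r≤ℓ with c ℕ.≤? x
... | no c≰x = ⊥-elim (ℕP.<-irrefl refl (ℕP.≤-trans 1≤r (subst (r ≤_) column-empty r≤ℓ)))
  where
  column-empty : colLen (x ∷ xs) c ≡ 0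
  column-empty = colLen-short (x ∷ xs)
    (All.map (λ y≤x → ℕP.≤-<-trans y≤x (ℕP.≰⇒> c≰x)) (Linked⇒All (flip ℕP.≤-trans) ℕP.≤-refl L))
colLen⇒rowLen {x ∷ xs} L {c} {suc zero} _ _ | yes c≤x = c≤x
colLen⇒rowLen {x ∷ xs} L {c} {suc (suc r)} _ r≤ℓ | yes c≤x =
  colLen⇒rowLen (Linked.tail L) (s≤s z≤n) (ℕP.≤-pred (subst (suc (suc r) ≤_) (colLen-cons-≤ xs c≤x) r≤ℓ))

rowLen⇒colLen : ∀ {ps} → Linked _≥_ ps → ∀ {c r} → 1 ≤ r → 1 ≤ c → c ≤ rowLen ps r → r ≤ colLen ps c
rowLen⇒colLen {[]} _ {r = suc r} _ 1≤c c≤0 = ⊥-elim (ℕP.<-irrefl refl (ℕP.≤-trans 1≤c c≤0))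
rowLen⇒colLen {x ∷ xs} L {r = suc zero} _ _ c≤x = subst (1 ≤_) (sym (colLen-cons-≤ xs c≤x)) (s≤s z≤n)
rowLen⇒colLen {x ∷ xs} L {c} {suc (suc r)} _ 1≤c c≤ℓ =
  subst (suc (suc r) ≤_) (sym (colLen-cons-≤ xs c≤x)) (s≤s (rowLen⇒colLen (Linked.tail L) (s≤s z≤n) 1≤c c≤ℓ))
  where
  c≤x : c ≤ x
  c≤x = ℕP.≤-trans c≤ℓ (rowLen-antitone L {1} {suc (suc r)} (s≤s z≤n) (s≤s z≤n))

firstPart≡rowLen₁ : ∀ ps → firstPart ps ≡ rowLen ps 1
firstPart≡rowLen₁ [] = refl
firstPart≡rowLen₁ (x ∷ xs) = refl

column : List ℕ → ℕ → List Box
column ps c = List.map (_, c) (oneTo (colLen ps c))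

∈-columnOrder⁻ : ∀ (λp : Partition n) {b} → b ∈ columnOrder (parts λp) → InShape λp b
∈-columnOrder⁻ λp {r , c} b∈ with find (MemP.∈-concatMap⁻ (column (parts λp)) {oneTo (firstPart (parts λp))} b∈)
... | c′ , c′∈ , b∈column with MemP.∈-map⁻ (_, c′) b∈column
... | r′ , r′∈ , refl =
  proj₁ (∈-oneTo⁻ c′∈) , colLen⇒rowLen (decreasing λp) (proj₁ (∈-oneTo⁻ r′∈)) (proj₂ (∈-oneTo⁻ r′∈))

∈-columnOrder⁺ : ∀ (λp : Partition n) {b} → InShape λp b → b ∈ columnOrder (parts λp)
∈-columnOrder⁺ λp {r , c} (1≤c , c≤ℓ) =
  MemP.∈-concatMap⁺ (column ps) (Any.map (λ { refl → in-column }) (∈-oneTo 1≤c c≤first))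
  where
  ps : List ℕ
  ps = parts λp
  1≤r : 1 ≤ r
  1≤r = inShape-row λp (1≤c , c≤ℓ)
  in-column : (r , c) ∈ column ps c
  in-column = MemP.∈-map⁺ (_, c) (∈-oneTo 1≤r (rowLen⇒colLen (decreasing λp) 1≤r 1≤c c≤ℓ))
  c≤first : c ≤ firstPart ps
  c≤first = subst (c ≤_) (sym (firstPart≡rowLen₁ ps))
                    (ℕP.≤-trans c≤ℓ (rowLen-antitone (decreasing λp) (s≤s z≤n) 1≤r))

oneTo-increasing : ∀ m → AllPairs _<_ (oneTo m)
oneTo-increasing m = AllPairsP.map⁺ (AllPairsP.applyUpTo⁺₁ (λ i → i) m (λ i<j _ → s≤s i<j))

columnOrder-increasing : ∀ ps → AllPairs _≺_ (columnOrder ps)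
columnOrder-increasing ps =
  AllPairsP.concat⁺ (AllP.map⁺ (All.universal within-column _))
                    (AllPairsP.map⁺ (AllPairs.map across-columns (oneTo-increasing (firstPart ps))))
  where
  within-column : ∀ c → AllPairs _≺_ (column ps c)
  within-column c = AllPairsP.map⁺ (AllPairs.map (λ r<r′ → inj₂ (refl , r<r′)) (oneTo-increasing (colLen ps c)))
  across-columns : ∀ {c c′} → c < c′ → All (λ x → All (x ≺_) (column ps c′)) (column ps c)
  across-columns c<c′ = AllP.map⁺ (All.universal (λ _ → AllP.map⁺ (All.universal (λ _ → inj₁ c<c′) _)) _)

AllPairs-reverse : ∀ {R : A → A → Set} {xs} → AllPairs R xs → AllPairs (flip R) (List.reverse xs)
AllPairs-reverse {xs = []} [] = []
AllPairs-reverse {R = R} {x ∷ xs} (x-R ∷ xs-R) = subst (AllPairs (flip R)) (sym (ListP.unfold-reverse x xs))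
  (AllPairsP.++⁺ (AllPairs-reverse xs-R) ([] ∷ []) (All.tabulate (λ y∈ → All.lookup x-R (AnyP.reverse⁻ y∈) ∷ [])))

sorted-unique : ∀ {R : A → A → Set} → (∀ {x y} → R x y → ¬ R y x) → ∀ {xs ys} →
  AllPairs R xs → AllPairs R ys → (∀ {z} → z ∈ xs → z ∈ ys) → (∀ {z} → z ∈ ys → z ∈ xs) → xs ≡ ys
sorted-unique asym {[]} {[]} _ _ _ _ = refl
sorted-unique asym {[]} {y ∷ ys} _ _ _ ⊇ with () ← ⊇ (here refl)
sorted-unique asym {x ∷ xs} {[]} _ _ ⊆ _ with () ← ⊆ (here refl)
sorted-unique {R = R} asym {x ∷ xs} {y ∷ ys} (x-R ∷ xs-R) (y-R ∷ ys-R) ⊆ ⊇ =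
  cong₂ _∷_ x≡y (sorted-unique asym xs-R ys-R ⊆-tail ⊇-tail)
  where
  irrefl : ∀ {z} → ¬ R z z
  irrefl Rzz = asym Rzz Rzz
  x≡y : x ≡ y
  x≡y with ⊆ (here refl) | ⊇ (here refl)
  ... | here x≡y | _ = x≡y
  ... | there x∈ys | here y≡x = ⊥-elim (irrefl (subst (R y) (sym y≡x) (All.lookup y-R x∈ys)))
  ... | there x∈ys | there y∈xs = ⊥-elim (asym (All.lookup y-R x∈ys) (All.lookup x-R y∈xs))
  ⊆-tail : ∀ {z} → z ∈ xs → z ∈ ys
  ⊆-tail z∈ with ⊆ (there z∈)
  ... | here refl = ⊥-elim (irrefl (subst (λ w → R w _) x≡y (All.lookup x-R z∈)))
  ... | there z∈′ = z∈′
  ⊇-tail : ∀ {z} → z ∈ ys → z ∈ xs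
  ⊇-tail z∈ with ⊇ (there z∈)
  ... | here refl = ⊥-elim (irrefl (subst (λ w → R w _) (sym x≡y) (All.lookup y-R z∈)))
  ... | there z∈′ = z∈′

toVec-toList : ∀ (d : A) (v : Vec A n) → toVec d (Vec.toList v) n ≡ v
toVec-toList d [] = refl
toVec-toList d (x ∷ v) = cong (x ∷_) (toVec-toList d v)

_≻_ : Box → Box → Set
x ≻ y = y ≺ x

-- A reverse standard tableau whose boxes, listed by entries 1, 2, …, N, go
-- strictly backwards in column order is τ_λ: both list the same boxes,
-- those of the shape, in the same strict order.
sorted⇒root : ∀ (λp : Partition n) {t : Tableau n} → IsRST λp t → Linked _≻_ (Vec.toList t) → t ≡ τroot λp
sorted⇒root {n} λp {t} rst sorted =
  trans (sym (toVec-toList (0 , 0) t)) (cong (λ bs → toVec (0 , 0) bs n) same-list)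
  where
  order : List Box
  order = columnOrder (parts λp)
  same-list : Vec.toList t ≡ List.reverse order
  same-list = sorted-unique (λ y≺x x≺y → ≺-asym x≺y y≺x)
    (LinkedP.Linked⇒AllPairs (λ x≻y y≻z → ≺-trans y≻z x≻y) sorted)
    (AllPairs-reverse (columnOrder-increasing (parts λp)))
    (λ b∈t → let i , b≡ = entry-of b∈t in
      AnyP.reverse⁺ (∈-columnOrder⁺ λp (subst (InShape λp) b≡ (IsRST.inShape rst i))))
    (λ b∈order → let i , ti≡b = rst-onto λp rst (∈-columnOrder⁻ λp (AnyP.reverse⁻ b∈order)) in
      subst (_∈ Vec.toList t) ti≡b (VecMemP.∈-toList⁺ (VecMemP.∈-lookup i t)))
    where
    entry-of : ∀ {b} → b ∈ Vec.toList t → ∃ λ i → lookup t i ≡ b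
    entry-of b∈t = let b∈ = VecMemP.∈-toList⁻ b∈t in VecAny.index b∈ , sym (VecAnyP.lookup-index b∈)

-- Exchanging the entries k+1 and k+2 of an RST whose boxes share neither a
-- row nor a column gives again an RST: the exchange only reverses the order
-- of these two entries, and they are never neighbours in a row or a column.
module _ {N : ℕ} (λp : Partition N) {t : Tableau N} (rst : IsRST λp t) {k} (k1 : suc k < N)
         (rows-differ : proj₁ (lookup t (lo k1)) ≢ proj₁ (lookup t (hi k1)))
         (columns-differ : proj₂ (lookup t (lo k1)) ≢ proj₂ (lookup t (hi k1))) where
  open IsRST rst

  private
    order-kept : ∀ i j → toℕ (swapIx k j) < toℕ (swapIx k i) →
                 toℕ j < toℕ i ⊎ (swapIx k j ≡ lo k1 × swapIx k i ≡ hi k1)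
    order-kept i j lt with swapIx-monotone k (swapIx k j) (swapIx k i) lt
    ... | inj₁ lt′ = inj₁ (subst₂ (λ a b → toℕ a < toℕ b) (swapIx-involutive k j) (swapIx-involutive k i) lt′)
    ... | inj₂ (j′≡k , i′≡k+1) = inj₂ (FinP.toℕ-injective (trans j′≡k (sym (toℕ-lo k1))) ,
                                        FinP.toℕ-injective (trans i′≡k+1 (sym (toℕ-hi k1))))

    moved : ∀ i {b} → lookup (swapAt k t) i ≡ b → lookup t (swapIx k i) ≡ b
    moved i e = trans (sym (lookup-swapAt k t i)) e

    -- in both neighbour relations the boxes share a coordinate f
    neighbours : (f : Box → ℕ) → f (lookup t (lo k1)) ≢ f (lookup t (hi k1)) → ∀ i j {bi bj} →
                 lookup t (swapIx k i) ≡ bi → lookup t (swapIx k j) ≡ bj → f bi ≡ f bj →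
                 toℕ (swapIx k j) < toℕ (swapIx k i) → toℕ j < toℕ i
    neighbours f differ i j ti tj same lt with order-kept i j lt
    ... | inj₁ j<i = j<i
    ... | inj₂ (j′≡lo , i′≡hi) = ⊥-elim (differ (begin
      f (lookup t (lo k1))          ≡⟨ cong (f ∘ lookup t) j′≡lo ⟨
      f (lookup t (swapIx k j))     ≡⟨ trans (cong f tj) (trans (sym same) (cong f (sym ti))) ⟩
      f (lookup t (swapIx k i))     ≡⟨ cong (f ∘ lookup t) i′≡hi ⟩
      f (lookup t (hi k1))          ∎))
      where open ≡-Reasoning

  exchange-RST : IsRST λp (swapAt k t)
  exchange-RST = record
    { inShape = λ i → subst (InShape λp) (sym (lookup-swapAt k t i)) (inShape (swapIx k i))
    ; injective = λ i j e → swapIx-injective k (injective _ _ (trans (moved i refl) (trans e (sym (moved j refl)))))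
    ; rowDecr = λ i j r c ti tj → neighbours proj₁ rows-differ i j (moved i ti) (moved j tj) refl
                                    (rowDecr _ _ r c (moved i ti) (moved j tj))
    ; colDecr = λ i j r c ti tj → neighbours proj₂ columns-differ i j (moved i ti) (moved j tj) refl
                                    (colDecr _ _ r c (moved i ti) (moved j tj)) }

-- If the box of entry k+1 precedes that of entry k+2 in column order, the
-- second box lies strictly east and strictly south of the first: any other
-- position would put the larger entry weakly north-east of the smaller one.
descent-separated : ∀ (λp : Partition n) {t : Tableau n} → IsRST λp t → ∀ {k} (k1 : suc k < n) →
  lookup t (lo k1) ≺ lookup t (hi k1) →
  proj₂ (lookup t (lo k1)) < proj₂ (lookup t (hi k1)) × proj₁ (lookup t (hi k1)) < proj₁ (lookup t (lo k1))
descent-separated λp {t} rst k1 x≺y with lookup t (lo k1) in tx | lookup t (hi k1) in ty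
descent-separated λp {t} rst k1 (inj₁ cx<cy) | (rx , cx) | (ry , cy) with ry ℕ.<? rx
... | yes ry<rx = cx<cy , ry<rx
... | no ry≮rx = ⊥-elim (hi-not-smaller (decreasing-northeast λp rst (lo k1) (hi k1) tx ty
                    (ℕP.≮⇒≥ ry≮rx) (ℕP.<⇒≤ cx<cy) (λ e → ℕP.<-irrefl (cong proj₂ e) cx<cy)))
  where
  hi-not-smaller : ¬ toℕ (hi k1) < toℕ (lo k1)
  hi-not-smaller lt = ℕP.<-asym (subst₂ _<_ (sym (toℕ-lo k1)) (sym (toℕ-hi k1)) (n<1+n _)) lt
descent-separated λp {t} rst k1 (inj₂ (refl , rx<ry)) | (rx , cx) | (ry , .cx) =
  ⊥-elim (hi-not-smaller (decreasing-northeast λp rst (lo k1) (hi k1) tx ty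
    (ℕP.<⇒≤ rx<ry) ℕP.≤-refl (λ e → ℕP.<-irrefl (cong proj₁ e) rx<ry)))
  where
  hi-not-smaller : ¬ toℕ (hi k1) < toℕ (lo k1)
  hi-not-smaller lt = ℕP.<-asym (subst₂ _<_ (sym (toℕ-lo k1)) (sym (toℕ-hi k1)) (n<1+n _)) lt

-- The number of pairs of positions i < j with v[i] ≺ v[j]: how far v is
-- from being listed backwards in column order.
inversions : Vec Box n → ℕ
inversions [] = 0
inversions (x ∷ xs) = tally (λ y → does (≺-dec x y)) xs + inversions xs

inversions-swapAt : ∀ {k} (k1 : suc k < n) (v : Vec Box n) → lookup v (lo k1) ≺ lookup v (hi k1) →
                    inversions (swapAt k v) < inversions v
inversions-swapAt {suc (suc _)} {zero} (s≤s (s≤s _)) (a ∷ b ∷ v) a≺b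
  rewrite dec-true (≺-dec a b) a≺b | dec-false (≺-dec b a) (≺-asym a≺b) =
  s≤s (ℕP.≤-reflexive (x∙yz≈y∙xz (tally (λ y → does (≺-dec b y)) v) (tally (λ y → does (≺-dec a y)) v) _))
inversions-swapAt {suc _} {suc k} (s≤s k1) (x ∷ v) lt =
  subst (λ m → m + inversions (swapAt k v) < _) (sym (tally-swapAt (λ y → does (≺-dec x y)) k v))
        (ℕP.+-monoʳ-< (tally (λ y → does (≺-dec x y)) v) (inversions-swapAt k1 v lt))

data BackwardsCheck (v : Vec Box n) : Set where
  backwards : Linked _≻_ (Vec.toList v) → BackwardsCheck v
  offending : ∀ {k} (k1 : suc k < n) → ¬ lookup v (lo k1) ≻ lookup v (hi k1) → BackwardsCheck v

backwardsCheck : (v : Vec Box n) → BackwardsCheck v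
backwardsCheck [] = backwards Linked.[]
backwardsCheck (x ∷ []) = backwards [-]
backwardsCheck (x ∷ y ∷ v) with ≺-dec y x | backwardsCheck (y ∷ v)
... | no x⊁y | _ = offending (s≤s (s≤s z≤n)) x⊁y
... | yes x≻y | backwards sorted = backwards (x≻y ∷ sorted)
... | yes _ | offending k1 bad = offending (s≤s k1) bad

content-gap : ∀ {x y : Box} → proj₂ x < proj₂ y → proj₁ y < proj₁ x → content y ℤ.- content x ℤ.≥ ℤ.+ 2
content-gap {r , c} {r′ , c′} c<c′ r′<r = begin
    + 2                          ≤⟨ ℤ.+≤+ (ℕP.m+n≤o⇒m≤o∸n 2 apart) ⟩
    + (c′ + r ∸ (r′ + c))        ≡⟨ ℤP.⊖-≥ (ℕP.m+n≤o⇒n≤o 2 apart) ⟨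
    (c′ + r) ℤ.⊖ (r′ + c)        ≡⟨ ℤP.m-n≡m⊖n (c′ + r) (r′ + c) ⟨
    + (c′ + r) - + (r′ + c)      ≡⟨ regroup (+ c′) (+ r′) (+ c) (+ r) ⟨
    (+ c′ - + r′) - (+ c - + r)  ∎
  where
  open ℤP.≤-Reasoning
  open Data.Integer using (+_; _-_)
  apart : 2 + (r′ + c) ≤ c′ + r
  apart = subst₂ _≤_ (cong suc (ℕP.+-suc r′ c)) (ℕP.+-comm r c′) (ℕP.+-mono-≤ r′<r c<c′)
  regroup : ∀ a b d e → (a - b) - (d - e) ≡ (a ℤ.+ e) - (b ℤ.+ d)
  regroup = solve-∀

-- If the boxes of the entries k+1, k+2 of t are in column order, one exchange
-- edge s_{k+1} (at v = 0, σ = id) leads from the tableau with these two entries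
-- exchanged back to t: the boxes are separated, so their contents differ by ≥ 2.
exchange-edge : ∀ (λp : Partition n) {t : Tableau n} → IsRST λp t → ∀ {k} (k1 : suc k < n) →
  lookup t (lo k1) ≺ lookup t (hi k1) → ∀ {ζ} →
  Reachable λp ⟨ swapAt k t , ζ , replicate n 0 , allFin n ⟩ →
  Reachable λp ⟨ t , swapAt k ζ , replicate n 0 , allFin n ⟩
exchange-edge {n} λp {t} rst {k} k1 x≺y {ζ} r =
  subst (λ u → Reachable λp ⟨ u , swapAt k ζ , replicate n 0 , allFin n ⟩) restored
    (step r (edgeS= t′ ζ (replicate n 0) (allFin n) k k1 both-zero (subst (IsRST λp) (sym restored) rst) changed gap))
  where
  open ≡-Reasoning
  t′ : Tableau n
  t′ = swapAt k t
  a b : Fin n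
  a = lookup (allFin n) (lo k1)
  b = lookup (allFin n) (hi k1)
  separated : proj₂ (lookup t (lo k1)) < proj₂ (lookup t (hi k1)) × proj₁ (lookup t (hi k1)) < proj₁ (lookup t (lo k1))
  separated = descent-separated λp rst k1 x≺y

  restored : swapEntries t′ a b ≡ t
  restored = begin
    swapEntries t′ a b                ≡⟨ cong₂ (swapEntries t′) (VecP.lookup-allFin _) (VecP.lookup-allFin _) ⟩
    swapEntries t′ (lo k1) (hi k1)    ≡⟨ swapEntries-adjacent k1 t′ ⟩
    swapAt k t′                       ≡⟨ swapAt-involutive k t ⟩
    t                                 ∎

  both-zero : lookup (replicate n 0) (lo k1) ≡ lookup (replicate n 0) (hi k1)
  both-zero = trans (VecP.lookup-replicate (lo k1) 0) (sym (VecP.lookup-replicate (hi k1) 0))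

  t′-a : lookup t′ a ≡ lookup t (hi k1)
  t′-a = trans (cong (lookup t′) (VecP.lookup-allFin _)) (trans (lookup-swapAt k t (lo k1)) (cong (lookup t) (swapIx-lo k1)))

  t′-b : lookup t′ b ≡ lookup t (lo k1)
  t′-b = trans (cong (lookup t′) (VecP.lookup-allFin _)) (trans (lookup-swapAt k t (hi k1)) (cong (lookup t) (swapIx-hi k1)))

  changed : ⟨ swapEntries t′ a b , swapAt k ζ , replicate n 0 , allFin n ⟩ ≢ ⟨ t′ , ζ , replicate n 0 , allFin n ⟩
  changed e = ≺-irrefl (subst (_≺ lookup t (hi k1)) same-box x≺y)
    where
    same-box : lookup t (lo k1) ≡ lookup t (hi k1)
    same-box = begin
      lookup t (lo k1)    ≡⟨ cong (λ u → lookup u (lo k1)) (trans (sym (cong tab e)) restored) ⟨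
      lookup t′ (lo k1)   ≡⟨ trans (lookup-swapAt k t (lo k1)) (cong (lookup t) (swapIx-lo k1)) ⟩
      lookup t (hi k1)    ∎

  gap : CT t′ a ℤ.- CT t′ b ℤ.≥ ℤ.+ 2
  gap = subst₂ (λ y x → content y ℤ.- content x ℤ.≥ ℤ.+ 2) (sym t′-a) (sym t′-b)
          (content-gap (proj₁ separated) (proj₂ separated))

-- Every RST τ occurs in a reachable vertex ⟨ τ , ζ , 0ᴺ , id ⟩: by induction
-- on its inversions, the sorted RST being τ_λ itself (the root).
every-rst-reachable : ∀ (λp : Partition n) {t : Tableau n} → IsRST λp t →
                      ∃[ ζ ] Reachable λp ⟨ t , ζ , replicate n 0 , allFin n ⟩
every-rst-reachable {n} λp {t} rst = by-inversions (inversions t) rst ℕP.≤-refl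
  where
  by-inversions : ∀ m {t} → IsRST λp t → inversions t ≤ m → ∃[ ζ ] Reachable λp ⟨ t , ζ , replicate n 0 , allFin n ⟩
  by-inversions m {t} rst bound with backwardsCheck t
  ... | backwards sorted =
    zeta (root λp) , subst (λ u → Reachable λp ⟨ u , zeta (root λp) , replicate n 0 , allFin n ⟩)
                           (sym (sorted⇒root λp rst sorted)) base
  ... | offending {k} k1 y⊀x with ≺-connex (lookup t (lo k1)) (lookup t (hi k1)) distinct
    where
    distinct : lookup t (lo k1) ≢ lookup t (hi k1)
    distinct e = lo≢hi k1 (IsRST.injective rst _ _ e)
  ... | inj₂ y≺x = ⊥-elim (y⊀x y≺x)
  ... | inj₁ x≺y with m | ℕP.<-≤-trans (inversions-swapAt k1 t x≺y) bound
  ...   | zero | ()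
  ...   | suc m′ | fewer =
    let separated = descent-separated λp rst k1 x≺y
        rst′ = exchange-RST λp rst k1 (ℕP.>⇒≢ (proj₂ separated)) (ℕP.<⇒≢ (proj₁ separated))
        ζ , r = by-inversions m′ rst′ (ℕP.≤-pred fewer)
    in swapAt k ζ , exchange-edge λp rst k1 x≺y r

corollary2p17 : (N : ℕ) (λp : Partition N) (τ : Tableau N) → IsRST λp τ →
    (v : Vec ℕ N) →
    ∃[ ζ ] ∃[ σ ] (Reachable λp ⟨ τ , ζ , v , σ ⟩ ×
      (∀ ζ′ σ′ → Reachable λp ⟨ τ , ζ′ , v , σ′ ⟩ → ζ′ ≡ ζ × σ′ ≡ σ))
corollary2p17 N λp τ rst v =
  let ζ , σ , r = reachable-any-v λp τ (every-rst-reachable λp rst) v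
  in ζ , σ , r , λ ζ′ σ′ r′ → coherent-unique (coherent-reachable λp r) (coherent-reachable λp r′)
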